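{- For any forward trie $\mathsf{T}_{\mathsf{f}}$ with $n$ nodes over an alphabet of size $\sigma$, $\mathsf{DAWG}(\mathsf{T}_{\mathsf{f}})$ has $O(\sigma n)$ edges. Moreover, there exist forward tries $\mathsf{T}_{\mathsf{f}}$ with $n$ nodes over an alphabet of size $\sigma$ (for $\sigma$ ranging from $\Theta(1)$ to $\Theta(n)$) such that $\mathsf{DAWG}(\mathsf{T}_{\mathsf{f}})$ has $\Omega(\sigma n)$ edges; in particular $\Omega(n^2)$ edges when $\sigma=\Theta(n)$.
   Context: Let $\Sigma$ be an ordered alphabet. A forward trie $\mathsf{T}_{\mathsf{f}}$ is a rooted tree with edges labeled by single characters of $\Sigma$, the out-going edges of each node having distinct labels. For $u$ an ancestor of $v$, $\mathit{str}_{\mathsf{f}}(u,v)$ is the string spelled by the downward path from $u$ to $v$, and $\mathit{Substr}(\mathsf{T}_{\mathsf{f}})$ is the set of all such strings. A string $X\in\mathit{Substr}(\mathsf{T}_{\mathsf{f}})$ is left-maximal on $\mathsf{T}_{\mathsf{f}}$ if either there are distinct $a,b\in\Sigma$ with $aX,bX\in\mathit{Substr}(\mathsf{T}_{\mathsf{f}})$, or $X=\mathit{str}_{\mathsf{f}}(r,v)$ for the root $r$ and some node $v$. $\mathit{l\text{ - }mxml}_{\mathsf{f}}(X)$ is the shortest left-maximal string of the form $\alpha X$, $\alpha\in\Sigma^*$. $\mathsf{DAWG}(\mathsf{T}_{\mathsf{f}})$ has one node per equivalence class of $\mathit{Substr}(\mathsf{T}_{\mathsf{f}})$ under $X\equiv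 X'$ iff $\mathit{l\text{ - }mxml}_{\mathsf{f}}(X)=\mathit{l\text{ - }mxml}_{\mathsf{f}}(X')$, and an edge labeled $a$ from the class of $X$ to the class of $Xa$ whenever $X,Xa\in\mathit{Substr}(\mathsf{T}_{\mathsf{f}})$. Convention: the root of the trie is connected to an auxiliary node $\bot$ by an edge labeled by a unique character $\$$ occurring nowhere else. -}

module Defs where

open import Data.Nat using (ℕ; suc; _+_; _≤_)
open import Data.Fin using (Fin)
open import Data.List using (List; []; _∷_; _++_; _∷ʳ_; map; length)
open import Data.List.Membership.Propositional using (_∈_)
open import Data.List.Relation.Unary.Unique.Propositional using (Unique)
open import Data.List.Relation.Unary.All using (All)
open import Data.Unit using (⊤)
open import Data.Product using (Σ; ∃; ∃₂; _×_; _,_; proj₁; proj₂)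
open import Data.Sum using (_⊎_)
open import Relation.Binary.PropositionalEquality using (_≡_; _≢_)

data Trie (σ : ℕ) : Set where
  node : List (Fin σ × Trie σ) → Trie σ

mutual
  WellFormed : ∀ {σ} → Trie σ → Set
  WellFormed (node cs) = Unique (map proj₁ cs) × WellFormedList cs

  WellFormedList : ∀ {σ} → List (Fin σ × Trie σ) → Set
  WellFormedList [] = ⊤
  WellFormedList (c ∷ cs) = WellFormed (proj₂ c) × WellFormedList cs

mutual
  size : ∀ {σ} → Trie σ → ℕ
  size (node cs) = suc (sizeList cs)

  sizeList : ∀ {σ} → List (Fin σ × Trie σ) → ℕ
  sizeList [] = 0
  sizeList (c ∷ cs) = size (proj₂ c) + sizeList cs

Str : ℕ → Set
Str σ = List (Fin σ)

data Path {σ : ℕ} : Trie σ → Str σ → Set where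
  here : ∀ {t} → Path t []
  step : ∀ {cs a u w} → (a , u) ∈ cs → Path u w → Path (node cs) (a ∷ w)

data SubtreeOf {σ : ℕ} : Trie σ → Trie σ → Set where
  self  : ∀ {t} → SubtreeOf t t
  child : ∀ {cs a u t} → (a , u) ∈ cs → SubtreeOf t u → SubtreeOf t (node cs)

Substr : ∀ {σ} → Trie σ → Str σ → Set
Substr T X = ∃ λ u → SubtreeOf u T × Path u X

LeftMaximal : ∀ {σ} → Trie σ → Str σ → Set
LeftMaximal T X =
  Substr T X ×
  ((∃₂ λ a b → a ≢ b × Substr T (a ∷ X) × Substr T (b ∷ X)) ⊎ Path T X)

LMxml : ∀ {σ} → Trie σ → Str σ → Str σ → Set
LMxml T X Y =
  ∃ λ α → Y ≡ α ++ X × LeftMaximal T Y ×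
    (∀ β → LeftMaximal T (β ++ X) → length α ≤ length β)

-- DAWG(T_f).  Each node (equivalence class) is identified by its
-- canonical representative l-mxml_f(X).  An edge is a triple
-- (class of X, a, class of Xa) for X, Xa ∈ Substr(T_f).

Edge : ℕ → Set
Edge σ = Str σ × Fin σ × Str σ

IsDAWGEdge : ∀ {σ} → Trie σ → Edge σ → Set
IsDAWGEdge T (Y , a , Z) =
  ∃ λ X → Substr T X × Substr T (X ∷ʳ a) × LMxml T X Y × LMxml T (X ∷ʳ a) Z

AtMostEdges : ∀ {σ} → Trie σ → ℕ → Set
AtMostEdges {σ} T k =
  ∃ λ (L : List (Edge σ)) → length L ≤ k × (∀ e → IsDAWGEdge T e → e ∈ L)

AtLeastEdges : ∀ {σ} → Trie σ → ℕ → Set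
AtLeastEdges {σ} T k =
  ∃ λ (L : List (Edge σ)) → k ≤ length L × Unique L × All (IsDAWGEdge T) L

-- A node of the DAWG is named by a left-maximal string Y, and an edge (Y, a, Z)
-- is determined by Y and a, since l-mxml(X a) = l-mxml(l-mxml(X) a).  The left-maximal strings
-- are the n root paths and the branching strings; adding the root paths one at a time, each new
-- path w creates at most one new branching string (the longest suffix of w occurring earlier),
-- exactly as in the node count of a suffix tree.  So there are at most 2n nodes and 2σn edges.
--
-- In the broom made of a path 0^m followed by s leaves with distinct labels d,
-- the only occurrences of a string ending in d are the 0^j d, so l-mxml(0^i d) = 0^m d for every
-- i ≤ m.  Each of the m + 1 nodes 0^i therefore has an out-edge for every leaf label, giving
-- m + (m + 1) s edges; with s ≈ σ/2 and n = m + s + 1 this is at least σn/8.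

module Submission where

open import Defs
open import Data.Nat
  using (ℕ; zero; suc; _+_; _*_; _∸_; _≤_; _<_; z≤n; s≤s; s≤s⁻¹; _≤?_; _⊓_; ⌊_/2⌋; ⌈_/2⌉)
open import Data.Nat.Properties
open import Data.Nat.Tactic.RingSolver using (solve)
open import Data.Fin using (Fin)
import Data.Fin as Fin
import Data.Fin.Properties as Fin
open import Data.List
  using (List; []; _∷_; _++_; _∷ʳ_; map; length; replicate; upTo; cartesianProduct; take; allFin; initLast; _∷ʳ′_)
open import Data.List.Properties
open import Data.List.Membership.Propositional using (_∈_; find; lose)
open import Data.List.Membership.Propositional.Properties
open import Data.List.Relation.Unary.Any as Any using (Any; here; there; any?)
import Data.List.Relation.Unary.All as All
import Data.List.Relation.Unary.All.Properties as All
open import Data.List.Relation.Unary.Unique.Propositional using (Unique)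
import Data.List.Relation.Unary.Unique.Propositional.Properties as Unique
import Data.List.Relation.Unary.AllPairs as AllPairs
open import Data.Product using (∃; ∃₂; _×_; _,_; proj₁; proj₂)
open import Data.Sum using (_⊎_; inj₁; inj₂)
open import Data.Empty using (⊥-elim)
open import Data.Unit using (tt)
open import Relation.Nullary using (¬_; Dec; yes; no)
open import Relation.Nullary.Decidable using (map′; _×-dec_; _⊎-dec_; ¬?)
open import Relation.Unary using (Decidable)
open import Relation.Binary.Definitions using (DecidableEquality)
open import Relation.Binary.PropositionalEquality
open import Function using (_∘_)

length-cartesianProduct : ∀ {A B : Set} (xs : List A) (ys : List B) →
                          length (cartesianProduct xs ys) ≡ length xs * length ys
length-cartesianProduct [] ys = refl
length-cartesianProduct (x ∷ xs) ys = begin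
  length (map (x ,_) ys ++ cartesianProduct xs ys)
    ≡⟨ length-++ (map (x ,_) ys) ⟩
  length (map (x ,_) ys) + length (cartesianProduct xs ys)
    ≡⟨ cong₂ _+_ (length-map (x ,_) ys) (length-cartesianProduct xs ys) ⟩
  length ys + length xs * length ys
    ∎
  where open ≡-Reasoning

length-++-cancelʳ-≤ : ∀ {A : Set} (xs ys zs : List A) →
                      length (xs ++ zs) ≤ length (ys ++ zs) → length xs ≤ length ys
length-++-cancelʳ-≤ xs ys zs le =
  +-cancelʳ-≤ (length zs) (length xs) (length ys) (subst₂ _≤_ (length-++ xs) (length-++ ys) le)

argminSuchThat : ∀ {A : Set} {P : A → Set} (f : A → ℕ) → Decidable P → (xs : List A) →
                   (∃ λ m → P m × ∀ {z} → z ∈ xs → P z → f m ≤ f z) ⊎ (∀ {z} → z ∈ xs → ¬ P z)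
argminSuchThat f P? [] = inj₂ λ ()
argminSuchThat f P? (x ∷ xs) with P? x | argminSuchThat f P? xs
... | no ¬px | inj₂ none = inj₂ λ { (here refl) → ¬px ; (there z∈) → none z∈ }
... | no ¬px | inj₁ (m , pm , least) =
  inj₁ (m , pm , λ { (here refl) pz → ⊥-elim (¬px pz) ; (there z∈) → least z∈ })
... | yes px | inj₂ none =
  inj₁ (x , px , λ { (here refl) _ → ≤-refl ; (there z∈) pz → ⊥-elim (none z∈ pz) })
... | yes px | inj₁ (m , pm , least) with f x ≤? f m
...   | yes x≤m =
  inj₁ (x , px , λ { (here refl) _ → ≤-refl ; (there z∈) pz → ≤-trans x≤m (least z∈ pz) })
...   | no x≰m =
  inj₁ (m , pm , λ { (here refl) _ → <⇒≤ (≰⇒> x≰m) ; (there z∈) → least z∈ })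

module _ {A : Set} where

  _IsSuffixOf_ : List A → List A → Set
  x IsSuffixOf s = ∃ λ γ → s ≡ γ ++ x

  isSuffixOf? : DecidableEquality A → ∀ x s → Dec (x IsSuffixOf s)
  isSuffixOf? _≟_ x s with ≡-dec _≟_ s x
  ... | yes refl = yes ([] , refl)
  isSuffixOf? _≟_ x [] | no []≢x = no λ { ([] , e) → []≢x e ; (_ ∷ _ , ()) }
  isSuffixOf? _≟_ x (c ∷ s) | no s≢x =
    map′ (λ (γ , e) → c ∷ γ , cong (c ∷_) e)
         (λ { ([] , e) → ⊥-elim (s≢x e) ; (_ ∷ γ , e) → γ , ∷-injectiveʳ e })
         (isSuffixOf? _≟_ x s)

  suffixOf-++⁻ : ∀ γ {x s} → (γ ++ x) IsSuffixOf s → x IsSuffixOf s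
  suffixOf-++⁻ γ {x} (δ , refl) = δ ++ γ , sym (++-assoc δ γ x)

  suffixOf-++⁺ : ∀ {x s} X → x IsSuffixOf s → (x ++ X) IsSuffixOf (s ++ X)
  suffixOf-++⁺ {x} X (γ , refl) = γ , ++-assoc γ x X

  suffixOf-length : ∀ {x s} → x IsSuffixOf s → length x ≤ length s
  suffixOf-length {x} (γ , refl) = length-++-≤ʳ x {γ}

  suffixOf-≡ : ∀ {x s} → x IsSuffixOf s → length s ≤ length x → x ≡ s
  suffixOf-≡ ([] , refl) _ = refl
  suffixOf-≡ {x} (c ∷ γ , refl) le = ⊥-elim (<⇒≱ (s≤s (length-++-≤ʳ x {γ})) le)

  suffixOf-∷-injective : ∀ {a b : A} {X s} → (a ∷ X) IsSuffixOf s → (b ∷ X) IsSuffixOf s → a ≡ b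
  suffixOf-∷-injective {a} {b} {X} (γ , refl) (δ , e) =
    ∷ʳ-injectiveʳ γ δ (++-cancelʳ X (γ ∷ʳ a) (δ ∷ʳ b)
      (trans (∷ʳ-++ γ a X) (trans e (sym (∷ʳ-++ δ b X)))))

  SuffixClosed : (List A → Set) → Set
  SuffixClosed P = ∀ γ x → P (γ ++ x) → P x

  longestSuffix : {P : List A → Set} → Decidable P → List A → List A
  longestSuffix P? [] = []
  longestSuffix P? (c ∷ w) with P? (c ∷ w)
  ... | yes _ = c ∷ w
  ... | no _ = longestSuffix P? w

  longestSuffix-self : ∀ {P} (P? : Decidable P) {x} → P x → longestSuffix P? x ≡ x
  longestSuffix-self P? {[]} _ = refl
  longestSuffix-self P? {c ∷ x} px with P? (c ∷ x)
  ... | yes _ = refl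
  ... | no ¬px = ⊥-elim (¬px px)

  longestSuffix-skip : ∀ {P} (P? : Decidable P) → SuffixClosed P → ∀ γ {a x} →
                       ¬ P (a ∷ x) → longestSuffix P? (γ ++ a ∷ x) ≡ longestSuffix P? x
  longestSuffix-skip P? closed [] {a} {x} ¬pax with P? (a ∷ x)
  ... | yes pax = ⊥-elim (¬pax pax)
  ... | no _ = refl
  longestSuffix-skip P? closed (c ∷ γ) {a} {x} ¬pax with P? (c ∷ γ ++ a ∷ x)
  ... | yes p = ⊥-elim (¬pax (closed (c ∷ γ) (a ∷ x) p))
  ... | no _ = longestSuffix-skip P? closed γ ¬pax

module _ {A : Set} where

  Occurs : List (List A) → List A → Set
  Occurs W x = Any (x IsSuffixOf_) W

  Branching : List (List A) → List A → Set
  Branching W X = ∃₂ λ a b → a ≢ b × Occurs W (a ∷ X) × Occurs W (b ∷ X)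

  LeftMaximalIn : List (List A) → List A → Set
  LeftMaximalIn W X = X ∈ W ⊎ Branching W X

  occurs? : DecidableEquality A → ∀ W → Decidable (Occurs W)
  occurs? _≟_ W x = any? (isSuffixOf? _≟_ x) W

  occurs-suffixClosed : ∀ W → SuffixClosed (Occurs W)
  occurs-suffixClosed W γ x = Any.map (suffixOf-++⁻ γ)

  branching-∷-fresh : (_≟_ : DecidableEquality A) → ∀ {w W X a b} → a ≢ b →
                      (a ∷ X) IsSuffixOf w → Occurs W (b ∷ X) →
                      Branching W X ⊎ X ≡ longestSuffix (occurs? _≟_ W) w
  branching-∷-fresh _≟_ {W = W} {X} {a} {b} a≢b (γ , refl) ob with occurs? _≟_ W (a ∷ X)
  ... | yes oa = inj₁ (a , b , a≢b , oa , ob)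
  ... | no ¬oa = inj₂ (sym (trans (longestSuffix-skip P? (occurs-suffixClosed W) γ ¬oa)
                                  (longestSuffix-self P? (occurs-suffixClosed W (b ∷ []) X ob))))
    where P? = occurs? _≟_ W

  branching-∷ : (_≟_ : DecidableEquality A) → ∀ {w W X} → Branching (w ∷ W) X →
                Branching W X ⊎ X ≡ longestSuffix (occurs? _≟_ W) w
  branching-∷ _≟_ (a , b , a≢b , here sa , here sb) = ⊥-elim (a≢b (suffixOf-∷-injective sa sb))
  branching-∷ _≟_ (a , b , a≢b , here sa , there ob) = branching-∷-fresh _≟_ a≢b sa ob
  branching-∷ _≟_ (a , b , a≢b , there oa , here sb) = branching-∷-fresh _≟_ (a≢b ∘ sym) sb oa
  branching-∷ _≟_ (a , b , a≢b , there oa , there ob) = inj₁ (a , b , a≢b , oa , ob)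

  leftMaximalIn-cover : DecidableEquality A → ∀ W →
    ∃ λ C → length C ≤ length W + length W × (∀ {X} → LeftMaximalIn W X → X ∈ C)
  leftMaximalIn-cover _≟_ [] = [] , z≤n , λ { (inj₁ ()) ; (inj₂ (_ , _ , _ , () , _)) }
  leftMaximalIn-cover _≟_ (w ∷ W) with leftMaximalIn-cover _≟_ W
  ... | C , |C|≤ , covers = w ∷ longestSuffix (occurs? _≟_ W) w ∷ C , |C′|≤ , covers′
    where
    |C′|≤ : suc (suc (length C)) ≤ suc (length W + suc (length W))
    |C′|≤ = s≤s (subst (suc (length C) ≤_) (sym (+-suc (length W) (length W))) (s≤s |C|≤))
    covers′ : ∀ {X} → LeftMaximalIn (w ∷ W) X → X ∈ w ∷ longestSuffix (occurs? _≟_ W) w ∷ C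
    covers′ (inj₁ (here refl)) = here refl
    covers′ (inj₁ (there X∈W)) = there (there (covers (inj₁ X∈W)))
    covers′ (inj₂ br) with branching-∷ _≟_ br
    ... | inj₁ br′ = there (there (covers (inj₂ br′)))
    ... | inj₂ refl = there (here refl)

module _ {σ : ℕ} where

  subtreeOf-trans : ∀ {t u v : Trie σ} → SubtreeOf t u → SubtreeOf u v → SubtreeOf t v
  subtreeOf-trans t⊑u self = t⊑u
  subtreeOf-trans t⊑u (child m u⊑v) = child m (subtreeOf-trans t⊑u u⊑v)

  path-++⁻ˡ : ∀ {u : Trie σ} x {y} → Path u (x ++ y) → Path u x
  path-++⁻ˡ [] _ = here
  path-++⁻ˡ (a ∷ x) (step m p) = step m (path-++⁻ˡ x p)

  path-++⁻ʳ : ∀ {u : Trie σ} γ {x} → Path u (γ ++ x) → Substr u x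
  path-++⁻ʳ [] p = _ , self , p
  path-++⁻ʳ (a ∷ γ) (step m p) with path-++⁻ʳ γ p
  ... | v , v⊑u , q = v , subtreeOf-trans v⊑u (child m self) , q

  substr-++⁻ˡ : ∀ {T : Trie σ} x {y} → Substr T (x ++ y) → Substr T x
  substr-++⁻ˡ x (u , u⊑T , p) = u , u⊑T , path-++⁻ˡ x p

  substr-++⁻ʳ : ∀ {T : Trie σ} γ {x} → Substr T (γ ++ x) → Substr T x
  substr-++⁻ʳ γ (u , u⊑T , p) with path-++⁻ʳ γ p
  ... | v , v⊑u , q = v , subtreeOf-trans v⊑u u⊑T , q

  subtree-path : ∀ {u T : Trie σ} {x} → SubtreeOf u T → Path u x → ∃ λ γ → Path T (γ ++ x)
  subtree-path self p = [] , p
  subtree-path (child {a = a} m u⊑t) p with subtree-path u⊑t p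
  ... | γ , q = a ∷ γ , step m q

  leftMaximal-∷ʳ⁻ : ∀ {T : Trie σ} X {a} → LeftMaximal T (X ∷ʳ a) → LeftMaximal T X
  leftMaximal-∷ʳ⁻ X (s , inj₁ (b , c , b≢c , sb , sc)) =
    substr-++⁻ˡ X s , inj₁ (b , c , b≢c , substr-++⁻ˡ (b ∷ X) sb , substr-++⁻ˡ (c ∷ X) sc)
  leftMaximal-∷ʳ⁻ X (s , inj₂ p) = substr-++⁻ˡ X s , inj₂ (path-++⁻ˡ X p)

  path⇒leftMaximal : ∀ {T : Trie σ} {x} → Path T x → LeftMaximal T x
  path⇒leftMaximal p = (_ , self , p) , inj₂ p

  path⇒lmxml : ∀ {T : Trie σ} {x} → Path T x → LMxml T x x
  path⇒lmxml p = [] , refl , path⇒leftMaximal p , λ _ _ → z≤n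

  mutual
    rootPaths : Trie σ → List (Str σ)
    rootPaths (node cs) = [] ∷ childPaths cs

    childPaths : List (Fin σ × Trie σ) → List (Str σ)
    childPaths [] = []
    childPaths ((a , u) ∷ cs) = map (a ∷_) (rootPaths u) ++ childPaths cs

  mutual
    length-rootPaths : ∀ T → length (rootPaths T) ≡ size T
    length-rootPaths (node cs) = cong suc (length-childPaths cs)

    length-childPaths : ∀ cs → length (childPaths cs) ≡ sizeList cs
    length-childPaths [] = refl
    length-childPaths ((a , u) ∷ cs) = begin
      length (map (a ∷_) (rootPaths u) ++ childPaths cs)        ≡⟨ length-++ (map (a ∷_) (rootPaths u)) ⟩
      length (map (a ∷_) (rootPaths u)) + length (childPaths cs) ≡⟨ cong (_+ _) (length-map (a ∷_) (rootPaths u)) ⟩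
      length (rootPaths u) + length (childPaths cs)              ≡⟨ cong₂ _+_ (length-rootPaths u) (length-childPaths cs) ⟩
      size u + sizeList cs                                       ∎
      where open ≡-Reasoning

  ∈-childPaths⁺ : ∀ {cs a u x} → (a , u) ∈ cs → x ∈ rootPaths u → (a ∷ x) ∈ childPaths cs
  ∈-childPaths⁺ {(b , v) ∷ cs} (here refl) x∈ = ∈-++⁺ˡ (∈-map⁺ (b ∷_) x∈)
  ∈-childPaths⁺ {(b , v) ∷ cs} (there m) x∈ = ∈-++⁺ʳ (map (b ∷_) (rootPaths v)) (∈-childPaths⁺ m x∈)

  path⇒∈rootPaths : ∀ {T x} → Path T x → x ∈ rootPaths T
  path⇒∈rootPaths {node cs} here = here refl
  path⇒∈rootPaths (step m p) = there (∈-childPaths⁺ m (path⇒∈rootPaths p))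

  mutual
    ∈rootPaths⇒path : ∀ T {x} → x ∈ rootPaths T → Path T x
    ∈rootPaths⇒path (node cs) (here refl) = here
    ∈rootPaths⇒path (node cs) (there x∈) = ∈childPaths⇒path cs x∈

    ∈childPaths⇒path : ∀ cs {x} → x ∈ childPaths cs → Path (node cs) x
    ∈childPaths⇒path ((a , u) ∷ cs) x∈ with ∈-++⁻ (map (a ∷_) (rootPaths u)) x∈
    ... | inj₁ x∈u with ∈-map⁻ (a ∷_) x∈u
    ...   | y , y∈ , refl = step (here refl) (∈rootPaths⇒path u y∈)
    ∈childPaths⇒path ((a , u) ∷ cs) x∈ | inj₂ x∈cs with ∈childPaths⇒path cs x∈cs
    ... | here = here
    ... | step m p = step (there m) p

  substr⇒occurs : ∀ {T x} → Substr T x → Occurs (rootPaths T) x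
  substr⇒occurs (u , u⊑T , p) with subtree-path u⊑T p
  ... | γ , q = lose (path⇒∈rootPaths q) (γ , refl)

  occurs⇒substr : ∀ {T x} → Occurs (rootPaths T) x → Substr T x
  occurs⇒substr {T} o with find o
  ... | _ , t∈ , γ , refl = substr-++⁻ʳ γ (T , self , ∈rootPaths⇒path T t∈)

  leftMaximal⇒leftMaximalIn : ∀ {T X} → LeftMaximal T X → LeftMaximalIn (rootPaths T) X
  leftMaximal⇒leftMaximalIn (_ , inj₁ (a , b , a≢b , sa , sb)) =
    inj₂ (a , b , a≢b , substr⇒occurs sa , substr⇒occurs sb)
  leftMaximal⇒leftMaximalIn (_ , inj₂ p) = inj₁ (path⇒∈rootPaths p)

  leftMaximalIn⇒leftMaximal : ∀ {T X} → LeftMaximalIn (rootPaths T) X → LeftMaximal T X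
  leftMaximalIn⇒leftMaximal {T} (inj₁ X∈) = path⇒leftMaximal (∈rootPaths⇒path T X∈)
  leftMaximalIn⇒leftMaximal (inj₂ (a , b , a≢b , oa , ob)) =
    substr-++⁻ʳ (a ∷ []) (occurs⇒substr oa) , inj₁ (a , b , a≢b , occurs⇒substr oa , occurs⇒substr ob)

  leftMaximal? : ∀ T → Decidable (LeftMaximal {σ} T)
  leftMaximal? T X = map′ leftMaximalIn⇒leftMaximal leftMaximal⇒leftMaximalIn
    (any? (≡-dec Fin._≟_ X) W ⊎-dec Fin.any? λ a → Fin.any? λ b →
       ¬? (a Fin.≟ b) ×-dec occurs? Fin._≟_ W (a ∷ X) ×-dec occurs? Fin._≟_ W (b ∷ X))
    where
    W = rootPaths T

  -- Two left contexts of X diverging within the length of α would make a shorter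
  -- extension of X branching, contradicting the minimality of α.
  leftContexts-comparable : ∀ {T : Trie σ} {X α} → Substr T (α ++ X) →
    (∀ β → LeftMaximal T (β ++ X) → length α ≤ length β) →
    ∀ β → Substr T (β ++ X) → β IsSuffixOf α ⊎ α IsSuffixOf β
  leftContexts-comparable {α = α} _ _ [] _ = inj₁ (α , sym (++-identityʳ α))
  leftContexts-comparable {T} {X} {α} sα least (b ∷ β) sbβ
    with leftContexts-comparable {T} {X} {α} sα least β (substr-++⁻ʳ (b ∷ []) sbβ)
  ... | inj₂ (γ , refl) = inj₂ (b ∷ γ , refl)
  ... | inj₁ (γ , refl) with initLast γ
  ...   | [] = inj₂ (b ∷ [] , refl)
  ...   | γ′ ∷ʳ′ c with b Fin.≟ c
  ...     | yes refl = inj₁ (γ′ , ∷ʳ-++ γ′ b β)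
  ...     | no b≢c = ⊥-elim (<⇒≱ |β|<|α| (least β (substr-++⁻ʳ (b ∷ []) sbβ , inj₁ (b , c , b≢c , sbβ , scβ))))
    where
    scβ : Substr T (c ∷ β ++ X)
    scβ = substr-++⁻ʳ γ′
      (subst (Substr T) (trans (cong (_++ X) (∷ʳ-++ γ′ c β)) (++-assoc γ′ (c ∷ β) X)) sα)
    |β|<|α| : length β < length (γ′ ∷ʳ c ++ β)
    |β|<|α| = suffixOf-length (γ′ , ∷ʳ-++ γ′ c β)

  lmxml-functional : ∀ {T : Trie σ} {X Y Z} → LMxml T X Y → LMxml T X Z → Y ≡ Z
  lmxml-functional {X = X} (α , refl , lmY , leastα) (β , refl , lmZ , leastβ)
    with leftContexts-comparable {X = X} {α} (proj₁ lmY) leastα β (proj₁ lmZ)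
  ... | inj₁ β⊑α = cong (_++ X) (sym (suffixOf-≡ β⊑α (leastα β lmZ)))
  ... | inj₂ α⊑β = cong (_++ X) (suffixOf-≡ α⊑β (leastβ α lmY))

  lmxml-suffixOf : ∀ {T : Trie σ} {X Y} β → LMxml T X Y → LeftMaximal T (β ++ X) →
                   Y IsSuffixOf (β ++ X)
  lmxml-suffixOf {X = X} β (α , refl , lmY , least) lmβ
    with leftContexts-comparable {X = X} {α} (proj₁ lmY) least β (proj₁ lmβ)
  ... | inj₁ β⊑α = [] , cong (_++ X) (suffixOf-≡ β⊑α (least β lmβ))
  ... | inj₂ α⊑β = suffixOf-++⁺ X α⊑β

  lmxml-∷ʳ : ∀ {T : Trie σ} {X Y Z a} → LMxml T X Y → LMxml T (X ∷ʳ a) Z → LMxml T (Y ∷ʳ a) Z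
  lmxml-∷ʳ {T} {X} {a = a} lmxmlY@(α , refl , _) (α₂ , refl , lmZ , least₂)
    with lmxml-suffixOf α₂ lmxmlY
           (leftMaximal-∷ʳ⁻ (α₂ ++ X) (subst (LeftMaximal T) (sym (++-assoc α₂ X _)) lmZ))
  ... | ρ , e with ++-cancelʳ X α₂ (ρ ++ α) (trans e (sym (++-assoc ρ α X)))
  ... | refl = ρ , reassoc ρ , lmZ , least
    where
    reassoc : ∀ β → (β ++ α) ++ X ∷ʳ a ≡ β ++ (α ++ X) ∷ʳ a
    reassoc β = trans (++-assoc β α (X ∷ʳ a)) (cong (β ++_) (sym (++-assoc α X (a ∷ []))))
    least : ∀ β → LeftMaximal T (β ++ (α ++ X) ∷ʳ a) → length ρ ≤ length β
    least β lm = length-++-cancelʳ-≤ ρ β α (least₂ (β ++ α) (subst (LeftMaximal T) (sym (reassoc β)) lm))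

module _ {σ : ℕ} (T : Trie σ) (C : List (Str σ)) where

  -- The default [] is a junk value, never used when C contains every left-maximal string.
  dawgTarget : Str σ → Fin σ → Str σ
  dawgTarget Y a with argminSuchThat length (λ z → leftMaximal? T z ×-dec isSuffixOf? Fin._≟_ (Y ∷ʳ a) z) C
  ... | inj₁ (Z , _) = Z
  ... | inj₂ _ = []

  lmxml⇒dawgTarget : (∀ {Z} → LeftMaximal T Z → Z ∈ C) →
                     ∀ {Y a Z} → LMxml T (Y ∷ʳ a) Z → dawgTarget Y a ≡ Z
  lmxml⇒dawgTarget covers {Y} {a} lmxmlZ@(ρ , eZ , lmZ , _)
    with argminSuchThat length (λ z → leftMaximal? T z ×-dec isSuffixOf? Fin._≟_ (Y ∷ʳ a) z) C
  ... | inj₂ none = ⊥-elim (none (covers lmZ) (lmZ , ρ , eZ))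
  ... | inj₁ (_ , (lm , ρ′ , refl) , least) = lmxml-functional (ρ′ , refl , lm , shortest) lmxmlZ
    where
    shortest : ∀ β → LeftMaximal T (β ++ Y ∷ʳ a) → length ρ′ ≤ length β
    shortest β lmβ = length-++-cancelʳ-≤ ρ′ β (Y ∷ʳ a) (least (covers lmβ) (lmβ , β , refl))

  dawgEdges : List (Edge σ)
  dawgEdges = map (λ (Y , a) → Y , a , dawgTarget Y a) (cartesianProduct C (allFin σ))

  atMostEdges : (∀ {Z} → LeftMaximal T Z → Z ∈ C) → AtMostEdges T (length C * σ)
  atMostEdges covers = dawgEdges , ≤-reflexive length-dawgEdges , listed
    where
    length-dawgEdges : length dawgEdges ≡ length C * σ
    length-dawgEdges = trans (length-map _ (cartesianProduct C (allFin σ)))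
      (trans (length-cartesianProduct C (allFin σ)) (cong (length C *_) (length-tabulate {n = σ} (λ i → i))))
    listed : ∀ e → IsDAWGEdge T e → e ∈ dawgEdges
    listed (Y , a , Z) (_ , _ , _ , lmxmlY@(_ , _ , lmY , _) , lmxmlZ) =
      subst (λ z → (Y , a , z) ∈ dawgEdges) (lmxml⇒dawgTarget covers (lmxml-∷ʳ lmxmlY lmxmlZ))
        (∈-map⁺ _ (∈-cartesianProduct⁺ (covers lmY) (∈-allFin a)))

atMostEdges-weaken : ∀ {σ} {T : Trie σ} {k l} → k ≤ l → AtMostEdges T k → AtMostEdges T l
atMostEdges-weaken k≤l (L , |L|≤k , listed) = L , ≤-trans |L|≤k k≤l , listed

upperBound : ∀ σ n (T : Trie σ) → size T ≡ n → AtMostEdges T (2 * σ * n)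
upperBound σ n T |T|≡n with leftMaximalIn-cover Fin._≟_ (rootPaths T)
... | C , |C|≤ , covers = atMostEdges-weaken bound (atMostEdges T C (covers ∘ leftMaximal⇒leftMaximalIn))
  where
  W = rootPaths T
  bound : length C * σ ≤ 2 * σ * n
  bound = begin
    length C * σ                ≤⟨ *-monoˡ-≤ σ |C|≤ ⟩
    (length W + length W) * σ   ≡⟨ cong (λ k → (k + k) * σ) (trans (length-rootPaths T) |T|≡n) ⟩
    (n + n) * σ                 ≡⟨ solve (n ∷ σ ∷ []) ⟩
    2 * σ * n                   ∎
    where open ≤-Reasoning

module Broom {σ : ℕ} (ds : List (Fin σ)) where

  leaf : Trie (suc σ)
  leaf = node []

  tooth : Fin σ → Fin (suc σ) × Trie (suc σ)
  tooth d = Fin.suc d , leaf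

  broom : ℕ → Trie (suc σ)
  broom zero = node (map tooth ds)
  broom (suc m) = node ((Fin.zero , broom m) ∷ [])

  zeros : ℕ → Str (suc σ)
  zeros k = replicate k Fin.zero

  zeros-+ : ∀ i j → zeros (i + j) ≡ zeros i ++ zeros j
  zeros-+ zero j = refl
  zeros-+ (suc i) j = cong (Fin.zero ∷_) (zeros-+ i j)

  zeros-∷ʳ : ∀ i → zeros i ∷ʳ Fin.zero ≡ zeros (suc i)
  zeros-∷ʳ zero = refl
  zeros-∷ʳ (suc i) = cong (Fin.zero ∷_) (zeros-∷ʳ i)

  zeros-injective : ∀ {i j} → zeros i ≡ zeros j → i ≡ j
  zeros-injective {i} {j} e = trans (sym (length-replicate i)) (trans (cong length e) (length-replicate j))

  ∷-zeros⇒zero : ∀ {b w} j → b ∷ w ≡ zeros j → b ≡ Fin.zero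
  ∷-zeros⇒zero (suc j) e = ∷-injectiveˡ e

  size-broom : ∀ m → size (broom m) ≡ m + suc (length ds)
  size-broom zero = cong suc (size-teeth ds)
    where
    size-teeth : ∀ xs → sizeList (map tooth xs) ≡ length xs
    size-teeth [] = refl
    size-teeth (_ ∷ xs) = cong suc (size-teeth xs)
  size-broom (suc m) = cong suc (trans (+-identityʳ _) (size-broom m))

  wellFormed-broom : Unique ds → ∀ m → WellFormed (broom m)
  wellFormed-broom u zero = subst Unique (map-∘ ds) (Unique.map⁺ Fin.suc-injective u) , wellFormed-teeth ds
    where
    wellFormed-teeth : ∀ xs → WellFormedList (map tooth xs)
    wellFormed-teeth [] = tt
    wellFormed-teeth (_ ∷ xs) = (AllPairs.[] , tt) , wellFormed-teeth xs
  wellFormed-broom u (suc m) = (All.[] AllPairs.∷ AllPairs.[]) , wellFormed-broom u m , tt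

  path-zeros : ∀ {k j} → k ≤ j → Path (broom j) (zeros k)
  path-zeros z≤n = here
  path-zeros (s≤s k≤j) = step (here refl) (path-zeros k≤j)

  path-tooth : ∀ {d} → d ∈ ds → ∀ j → Path (broom j) (zeros j ∷ʳ Fin.suc d)
  path-tooth d∈ zero = step (∈-map⁺ tooth d∈) here
  path-tooth d∈ (suc j) = step (here refl) (path-tooth d∈ j)

  subtreeOf-broom : ∀ k i → SubtreeOf (broom i) (broom (k + i))
  subtreeOf-broom zero i = self
  subtreeOf-broom (suc k) i = child (here refl) (subtreeOf-broom k i)

  subtreeOf-broom⁻ : ∀ {u} j → SubtreeOf u (broom j) → (∃ λ i → u ≡ broom i) ⊎ u ≡ leaf
  subtreeOf-broom⁻ zero self = inj₁ (zero , refl)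
  subtreeOf-broom⁻ (suc j) self = inj₁ (suc j , refl)
  subtreeOf-broom⁻ zero (child m u⊑) with ∈-map⁻ tooth m
  ... | _ , _ , refl with u⊑
  ...   | self = inj₂ refl
  subtreeOf-broom⁻ (suc j) (child (here refl) u⊑) = subtreeOf-broom⁻ j u⊑

  ¬path-leaf : ∀ w {x} → ¬ Path leaf (w ∷ʳ x)
  ¬path-leaf [] (step () _)
  ¬path-leaf (_ ∷ _) (step () _)

  path-broom-tooth⁻ : ∀ j w {d} → Path (broom j) (w ∷ʳ Fin.suc d) → w ≡ zeros j
  path-broom-tooth⁻ zero [] _ = refl
  path-broom-tooth⁻ zero (_ ∷ w) (step m p) with ∈-map⁻ tooth m
  ... | _ , _ , refl = ⊥-elim (¬path-leaf w p)
  path-broom-tooth⁻ (suc j) [] (step (here ()) _)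
  path-broom-tooth⁻ (suc j) (_ ∷ w) (step (here refl) p) = cong (Fin.zero ∷_) (path-broom-tooth⁻ j w p)

  substr-broom-tooth⁻ : ∀ m w {d} → Substr (broom m) (w ∷ʳ Fin.suc d) → ∃ λ j → w ≡ zeros j
  substr-broom-tooth⁻ m w (u , u⊑ , p) with subtreeOf-broom⁻ m u⊑
  ... | inj₁ (i , refl) = i , path-broom-tooth⁻ i w p
  ... | inj₂ refl = ⊥-elim (¬path-leaf w p)

  lmxml-tooth : ∀ {m i d} → i ≤ m → d ∈ ds →
                LMxml (broom m) (zeros i ∷ʳ Fin.suc d) (zeros m ∷ʳ Fin.suc d)
  lmxml-tooth {m} {i} {d} i≤m d∈ = zeros (m ∸ i) , split , path⇒leftMaximal (path-tooth d∈ m) , least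
    where
    split : zeros m ∷ʳ Fin.suc d ≡ zeros (m ∸ i) ++ zeros i ∷ʳ Fin.suc d
    split = begin
      zeros m ∷ʳ Fin.suc d                   ≡⟨ cong (λ k → zeros k ∷ʳ Fin.suc d) (sym (m∸n+n≡m i≤m)) ⟩
      zeros (m ∸ i + i) ∷ʳ Fin.suc d         ≡⟨ cong (_∷ʳ Fin.suc d) (zeros-+ (m ∸ i) i) ⟩
      (zeros (m ∸ i) ++ zeros i) ∷ʳ Fin.suc d ≡⟨ ++-assoc (zeros (m ∸ i)) (zeros i) _ ⟩
      zeros (m ∸ i) ++ zeros i ∷ʳ Fin.suc d   ∎
      where open ≡-Reasoning
    reassoc : ∀ β → β ++ zeros i ∷ʳ Fin.suc d ≡ (β ++ zeros i) ∷ʳ Fin.suc d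
    reassoc β = sym (++-assoc β (zeros i) _)
    extends-by-zero : ∀ {b} β → Substr (broom m) (b ∷ β ++ zeros i ∷ʳ Fin.suc d) → b ≡ Fin.zero
    extends-by-zero {b} β s
      with substr-broom-tooth⁻ m (b ∷ β ++ zeros i) (subst (Substr (broom m)) (cong (b ∷_) (reassoc β)) s)
    ... | j , e = ∷-zeros⇒zero j e
    least : ∀ β → LeftMaximal (broom m) (β ++ zeros i ∷ʳ Fin.suc d) → length (zeros (m ∸ i)) ≤ length β
    least β (_ , inj₁ (b , c , b≢c , sb , sc)) =
      ⊥-elim (b≢c (trans (extends-by-zero β sb) (sym (extends-by-zero β sc))))
    least β (_ , inj₂ p) = ≤-reflexive (begin
      length (zeros (m ∸ i))      ≡⟨ length-replicate (m ∸ i) ⟩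
      m ∸ i                       ≡⟨ cong (_∸ i) (sym (length-replicate m)) ⟩
      length (zeros m) ∸ i        ≡⟨ cong (λ w → length w ∸ i) (sym β++zeros≡zeros) ⟩
      length (β ++ zeros i) ∸ i   ≡⟨ cong (_∸ i) (trans (length-++ β) (cong (length β +_) (length-replicate i))) ⟩
      length β + i ∸ i            ≡⟨ m+n∸n≡m (length β) i ⟩
      length β                    ∎)
      where
      open ≡-Reasoning
      β++zeros≡zeros : β ++ zeros i ≡ zeros m
      β++zeros≡zeros = path-broom-tooth⁻ m (β ++ zeros i) (subst (Path (broom m)) (reassoc β) p)

  spineEdge : ℕ → Edge (suc σ)
  spineEdge i = zeros i , Fin.zero , zeros (suc i)

  toothEdge : ℕ → ℕ × Fin σ → Edge (suc σ)
  toothEdge m (i , d) = zeros i , Fin.suc d , zeros m ∷ʳ Fin.suc d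

  spineEdge-isDAWGEdge : ∀ {m i} → i < m → IsDAWGEdge (broom m) (spineEdge i)
  spineEdge-isDAWGEdge {m} {i} i<m =
    zeros i , (_ , self , path-zeros (<⇒≤ i<m)) , (_ , self , subst (Path (broom m)) (sym (zeros-∷ʳ i)) p) ,
    path⇒lmxml (path-zeros (<⇒≤ i<m)) ,
    subst (λ x → LMxml (broom m) x (zeros (suc i))) (sym (zeros-∷ʳ i)) (path⇒lmxml p)
    where
    p : Path (broom m) (zeros (suc i))
    p = path-zeros i<m

  toothEdge-isDAWGEdge : ∀ {m i d} → i ≤ m → d ∈ ds → IsDAWGEdge (broom m) (toothEdge m (i , d))
  toothEdge-isDAWGEdge {m} {i} i≤m d∈ =
    zeros i , (_ , self , path-zeros i≤m) ,
    (broom i , subst (SubtreeOf (broom i) ∘ broom) (m∸n+n≡m i≤m) (subtreeOf-broom (m ∸ i) i) , path-tooth d∈ i) ,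
    path⇒lmxml (path-zeros i≤m) , lmxml-tooth i≤m d∈

  toothIndices : ℕ → List (ℕ × Fin σ)
  toothIndices m = cartesianProduct (upTo (suc m)) ds

  broomEdges : ℕ → List (Edge (suc σ))
  broomEdges m = map spineEdge (upTo m) ++ map (toothEdge m) (toothIndices m)

  atLeastEdges-broom : Unique ds → ∀ m → AtLeastEdges (broom m) (m + suc m * length ds)
  atLeastEdges-broom u m =
    broomEdges m , ≤-reflexive (sym length-broomEdges) , unique , All.++⁺ (All.tabulate spine) (All.tabulate teeth)
    where
    spine : ∀ {e} → e ∈ map spineEdge (upTo m) → IsDAWGEdge (broom m) e
    spine e∈ with ∈-map⁻ spineEdge e∈
    ... | i , i∈ , refl = spineEdge-isDAWGEdge (∈-upTo⁻ i∈)
    teeth : ∀ {e} → e ∈ map (toothEdge m) (toothIndices m) → IsDAWGEdge (broom m) e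
    teeth e∈ with ∈-map⁻ (toothEdge m) e∈
    ... | (i , d) , id∈ , refl with ∈-cartesianProduct⁻ (upTo (suc m)) ds id∈
    ...   | i∈ , d∈ = toothEdge-isDAWGEdge (s≤s⁻¹ (∈-upTo⁻ i∈)) d∈
    unique : Unique (broomEdges m)
    unique = Unique.++⁺ (Unique.map⁺ spine-injective (Unique.upTo⁺ m))
                        (Unique.map⁺ tooth-injective (Unique.cartesianProduct⁺ (Unique.upTo⁺ (suc m)) u)) disjoint
      where
      spine-injective : ∀ {i j} → spineEdge i ≡ spineEdge j → i ≡ j
      spine-injective e = zeros-injective (cong proj₁ e)
      tooth-injective : ∀ {x y} → toothEdge m x ≡ toothEdge m y → x ≡ y
      tooth-injective e = cong₂ _,_ (zeros-injective (cong proj₁ e)) (Fin.suc-injective (cong (proj₁ ∘ proj₂) e))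
      disjoint : ∀ {e} → ¬ (e ∈ map spineEdge (upTo m) × e ∈ map (toothEdge m) (toothIndices m))
      disjoint (e∈ , e∈′) with ∈-map⁻ spineEdge e∈ | ∈-map⁻ (toothEdge m) e∈′
      ... | _ , _ , refl | _ , _ , ()
    length-broomEdges : length (broomEdges m) ≡ m + suc m * length ds
    length-broomEdges = begin
      length (broomEdges m)
        ≡⟨ length-++ (map spineEdge (upTo m)) ⟩
      length (map spineEdge (upTo m)) + length (map (toothEdge m) (toothIndices m))
        ≡⟨ cong₂ _+_ (length-map spineEdge (upTo m)) (length-map (toothEdge m) (toothIndices m)) ⟩
      length (upTo m) + length (toothIndices m)
        ≡⟨ cong (length (upTo m) +_) (length-cartesianProduct (upTo (suc m)) ds) ⟩
      length (upTo m) + length (upTo (suc m)) * length ds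
        ≡⟨ cong₂ (λ k l → k + l * length ds) (length-upTo m) (length-upTo (suc m)) ⟩
      m + suc m * length ds
        ∎
      where open ≡-Reasoning

halving : ∀ n → ⌊ n /2⌋ + ⌊ n /2⌋ ≤ n × n ≤ suc (⌊ n /2⌋ + ⌊ n /2⌋)
halving n = subst (h + h ≤_) h+⌈n/2⌉≡n (+-monoʳ-≤ h (⌊n/2⌋≤⌈n/2⌉ n)) ,
            subst (_≤ suc (h + h)) h+⌈n/2⌉≡n (subst (h + ⌈ n /2⌉ ≤_) (+-suc h h) (+-monoʳ-≤ h ⌈n/2⌉≤1+h))
  where
  h = ⌊ n /2⌋
  h+⌈n/2⌉≡n : h + ⌈ n /2⌉ ≡ n
  h+⌈n/2⌉≡n = ⌊n/2⌋+⌈n/2⌉≡n n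
  ⌈n/2⌉≤1+h : ⌈ n /2⌉ ≤ suc h
  ⌈n/2⌉≤1+h = ⌊n/2⌋-mono (n≤1+n (suc n))

σ*n≤8*edges : ∀ {σ} m s → s ≤ m → 2 ≤ m + suc s → σ ≤ suc s + suc s →
              σ * (m + suc s) ≤ 8 * (m + suc m * s)
σ*n≤8*edges zero .zero z≤n (s≤s ())
σ*n≤8*edges {σ} (suc m) s s≤m _ σ≤ = begin
  σ * (suc m + suc s)
    ≤⟨ *-mono-≤ σ≤ (+-monoʳ-≤ (suc m) (s≤s s≤m)) ⟩
  (suc s + suc s) * (suc m + suc (suc m))
    ≤⟨ m≤m+n _ (4 * (m * s) + 10 * s + 4 * m + 2) ⟩
  (suc s + suc s) * (suc m + suc (suc m)) + (4 * (m * s) + 10 * s + 4 * m + 2)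
    ≡⟨ solve (m ∷ s ∷ []) ⟩
  8 * (suc m + suc (suc m) * s)
    ∎
  where open ≤-Reasoning

lowerBound : ∀ σ n → 2 ≤ n → 1 ≤ σ → σ ≤ n →
  ∃ λ (T : Trie σ) → WellFormed T × size T ≡ n × ∃ λ k → AtLeastEdges T k × σ * n ≤ 8 * k
lowerBound (suc σ) n 2≤n _ σ<n =
  broom m , wellFormed-broom unique m , size≡n , _ , atLeastEdges-broom unique m ,
  subst₂ (λ k l → suc σ * k ≤ 8 * (m + suc m * l)) m+s+1≡n (sym length-ds)
    (σ*n≤8*edges m s s≤m (subst (2 ≤_) (sym m+s+1≡n) 2≤n) σ+1≤2s+2)
  where
  s = ⌊ σ /2⌋
  ds = take s (allFin σ)
  open Broom ds
  unique : Unique ds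
  unique = Unique.take⁺ s (Unique.allFin⁺ σ)
  length-ds : length ds ≡ s
  length-ds = trans (length-take s (allFin σ))
    (trans (cong (s ⊓_) (length-tabulate {n = σ} (λ i → i))) (m≤n⇒m⊓n≡m (⌊n/2⌋≤n σ)))
  m = n ∸ suc s
  m+s+1≡n : m + suc s ≡ n
  m+s+1≡n = m∸n+n≡m (≤-trans (s≤s (⌊n/2⌋≤n σ)) σ<n)
  size≡n : size (broom m) ≡ n
  size≡n = trans (size-broom m) (trans (cong (λ k → m + suc k) length-ds) m+s+1≡n)
  s≤m : s ≤ m
  s≤m = +-cancelʳ-≤ (suc s) s m
    (subst₂ _≤_ (sym (+-suc s s)) (sym m+s+1≡n) (≤-trans (s≤s (proj₁ (halving σ))) σ<n))
  σ+1≤2s+2 : suc σ ≤ suc s + suc s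
  σ+1≤2s+2 = subst (suc σ ≤_) (sym (cong suc (+-suc s s))) (s≤s (proj₂ (halving σ)))

theorem6 :
    -- upper bound: DAWG(T) has O(σ n) edges
    (∃ λ (c : ℕ) → ∀ (σ n : ℕ) (T : Trie σ) → WellFormed T → size T ≡ n →
        AtMostEdges T (c * σ * n))
    ×
    -- lower bound: Ω(σ n) edges, for every alphabet size 1 ≤ σ ≤ n
    (∃ λ (c : ℕ) → ∃ λ (n₀ : ℕ) → ∀ (σ n : ℕ) → n₀ ≤ n → 1 ≤ σ → σ ≤ n →
        ∃ λ (T : Trie σ) → WellFormed T × size T ≡ n ×
          ∃ λ (k : ℕ) → AtLeastEdges T k × σ * n ≤ c * k)
theorem6 = (2 , λ σ n T _ → upperBound σ n T) , (8 , 2 , lowerBound)
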